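{- Work in the field $\mathbb{Q}(a,b)$ of rational functions in two indeterminates $a,b$, and regard each of the symbols $(1)_k,\ (2)_k\dot-(1)_k,\ (2)_k,\ (3)_k,\ (4)_k$ below as a formal fraction, i.e. an ordered pair (numerator, denominator). For every $k\ge0$ the following relations hold (the notation $\frac{P}{Q}=c\cdot\frac{P'}{Q'}\dot+\frac{P''}{Q''}$ meaning $P=cP'+P''$ and $Q=cQ'+Q''$): $$(1)_k=c_k\cdot(4)_{k-1}\,\dot+\,(3)_{k-1},\qquad (2)_k\dot-(1)_k=d_k\cdot(1)_k\,\dot+\,(4)_{k-1},\qquad (2)_k=1\cdot\big((2)_k\dot-(1)_k\big)\,\dot+\,(1)_k,$$ $$(3)_k=e_k\cdot(2)_k\,\dot+\,\big((2)_k\dot-(1)_k\big),\qquad (4)_k=f_k\cdot(3)_k\,\dot+\,(2)_k.$$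
   Context: Let $\theta\in(0,1)$ be irrational with $\theta=[0;a_1,a_2,\ldots]$ and convergents $p_k/q_k$ ($p_{ -1}=1,q_{ -1}=0,p_0=0,q_0=1$, $p_{k+1}=a_{k+1}p_k+p_{k-1}$, $q_{k+1}=a_{k+1}q_k+q_{k-1}$). Let $\rho\in[0,1)$ and let $(b_k)_{k\ge1}$ be the digits of $\rho-\theta$ in the Ostrowski numeration system with base $\theta$: $\rho-\theta=\sum_{k\ge0}b_{k+1}(q_k\theta-p_k)$, with $0\le b_1\le a_1-1$, $0\le b_k\le a_k$ ($k\ge2$), $b_{k+1}=a_{k+1}\Rightarrow b_k=0$ ($k\ge1$) (normalized as in the authors' earlier work on Sturmian words). For $k\ge0$: $t_k=\sum_{j=1}^k b_jq_{j-1}$, $\tilde t_k=\sum_{j=1}^kb_jp_{j-1}$, $r_k=q_k-t_k$, $\tilde r_k=p_k-\tilde t_k$. Words: the characteristic word of slope $\theta$ is $\mathbf{c}_\theta=c_1c_2\ldots$ with $c_n=\lfloor (n+1)\theta\rfloor-\lfloor n\theta\rfloor$; for $k\ge1$, $M_k$ is its prefix of length $q_k$; $M_0=0$, $M_{ -1}=1$. Let $T_0$ be the empty word, $R_0=0$, and for $k\ge0$: $T_{k+1}=M_k^{b_{k+1}}T_k$; $R_{k+1}=R_kM_k^{a_{k+1}-b_{k+1}-1}M_{k-1}$ if $b_{k+1}<a_{k+1}$, and $R_{k+1}=R_{k-1}$ if $b_{k+1}=a_{k+1}$. Put $V_k=R_kT_k$. Juxtaposition of words denotes concatenation, $W^m$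 the $m$-fold concatenation. For a finite word $W=w_1\ldots w_\ell$ over $\{0,1\}$, $W(b,a)=\sum_{n=1}^\ell w_nb^{\ell-n}a^{\sum_{h=n+1}^\ell w_h}$. Formal fractions, for $k\ge0$: $(1)_k=\big((b-1)(R_{k+1}(b,a)-R_k(b,a)),\ b^{r_{k+1}}a^{\tilde r_{k+1}}-b^{r_k}a^{\tilde r_k}\big)$; $(2)_k=\big((b-1)(R_{k+1}T_k)(b,a),\ b^{r_{k+1}+t_k}a^{\tilde r_{k+1}+\tilde t_k}-1\big)$; $(3)_k=\big((b-1)((R_{k+1}M_k)(b,a)-R_{k+1}(b,a)),\ b^{r_{k+1}}a^{\tilde r_{k+1}}(b^{q_k}a^{p_k}-1)\big)$; $(4)_k=\big((b-1)V_{k+1}(b,a),\ b^{q_{k+1}}a^{p_{k+1}}-1\big)$; and $(3)_{ -1}=(b-1,\,0)$, $(4)_{ -1}=(0,\,b-1)$. $(2)_k\dot-(1)_k$ is the pair whose numerator (resp. denominator) is the numerator (resp. denominator) of $(2)_k$ minus that of $(1)_k$. Coefficients: $c_0=\frac{b^{a_1-b_1}a-b}{b-1}$; for $k\ge1$, $c_k=\frac{b^{r_k+q_{k-1}}a^{\tilde r_k+p_{k-1}}((b^{q_k}a^{p_k})^{a_{k+1}-b_{k+1}-1}-1)}{b^{q_k}a^{p_k}-1}$; $d_k=b^{t_k}a^{\tilde t_k}-1$; $e_k=b^{r_k}a^{\tilde r_k}-1$; $f_k=b^{t_k}a^{\tilde t_k}\frac{(b^{q_k}a^{p_k})^{b_{k+1}}-1}{b^{q_k}a^{p_k}-1}$.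 -}

module Defs where

open import Level using (Level; _⊔_) renaming (suc to lsuc)
open import Data.Bool using (Bool; true; false; if_then_else_)
open import Data.Nat as ℕ using (ℕ; zero; suc; _∸_; _<ᵇ_)
open import Data.Integer as ℤ using (ℤ; +_; -[1+_])
open import Data.List using (List; []; _∷_; _++_; length; replicate; concat)
open import Data.Product using (_×_; _,_; proj₁; proj₂)
open import Algebra.Bundles using (CommutativeRing)
open import Relation.Nullary using (¬_)

record Field (c ℓ : Level) : Set (lsuc (c ⊔ ℓ)) where
  field
    commutativeRing : CommutativeRing c ℓ
  open CommutativeRing commutativeRing public
  field
    _⁻¹       : Carrier → Carrier
    0≉1       : ¬ (0# ≈ 1#)
    ⁻¹-inverse : ∀ x → ¬ (x ≈ 0#) → x * (x ⁻¹) ≈ 1#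

-- Combinatorial data attached to theta (continued fraction digits A k = a_k,
-- k ≥ 1; A 0 is unused) and to rho (Ostrowski digits B k = b_k, k ≥ 1;
-- B 0 is unused).

CFDigits : (ℕ → ℕ) → Set
CFDigits A = ∀ k → 1 ℕ.≤ A (suc k)

OstrowskiDigits : (ℕ → ℕ) → (ℕ → ℕ) → Set
OstrowskiDigits A B =
  (B 1 ℕ.< A 1) ×
  (∀ k → B (suc (suc k)) ℕ.≤ A (suc (suc k))) ×
  (∀ k → B (suc (suc k)) ≡ A (suc (suc k)) → B (suc k) ≡ 0)
  where open import Relation.Binary.PropositionalEquality using (_≡_)

module Sturm (A B : ℕ → ℕ) where

  q : ℕ → ℕ
  q zero = 1
  q (suc zero) = A 1
  q (suc (suc k)) = A (suc (suc k)) ℕ.* q (suc k) ℕ.+ q k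

  p : ℕ → ℕ
  p zero = 0
  p (suc zero) = 1
  p (suc (suc k)) = A (suc (suc k)) ℕ.* p (suc k) ℕ.+ p k

  q⁻ : ℕ → ℕ
  q⁻ zero = 0
  q⁻ (suc k) = q k

  p⁻ : ℕ → ℕ
  p⁻ zero = 1
  p⁻ (suc k) = p k

  -- Words over {0,1}, letters encoded as false = 0, true = 1.
  Word : Set
  Word = List Bool

  _^w_ : Word → ℕ → Word
  W ^w zero = []
  W ^w suc m = W ++ (W ^w m)

  -- M k = M_k (k ≥ 0): prefix of length q_k of the characteristic word,
  -- given by the standard recursion M_1 = M_0^{a_1 - 1} M_{-1},
  -- M_{k} = M_{k-1}^{a_k} M_{k-2} (k ≥ 2), M_0 = 0, M_{-1} = 1.
  M : ℕ → Word
  M zero = false ∷ []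
  M (suc zero) = ((false ∷ []) ^w (A 1 ∸ 1)) ++ (true ∷ [])
  M (suc (suc k)) = (M (suc k) ^w A (suc (suc k))) ++ M k

  M⁻ : ℕ → Word
  M⁻ zero = true ∷ []
  M⁻ (suc k) = M k

  t : ℕ → ℕ
  t zero = 0
  t (suc k) = t k ℕ.+ B (suc k) ℕ.* q k

  t̃ : ℕ → ℕ
  t̃ zero = 0
  t̃ (suc k) = t̃ k ℕ.+ B (suc k) ℕ.* p k

  r : ℕ → ℤ
  r k = + q k ℤ.- + t k

  r̃ : ℕ → ℤ
  r̃ k = + p k ℤ.- + t̃ k

  T : ℕ → Word
  T zero = []
  T (suc k) = (M k ^w B (suc k)) ++ T k

  -- R_{k+1} = R_k M_k^{a_{k+1}-b_{k+1}-1} M_{k-1} if b_{k+1} < a_{k+1},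
  --         = R_{k-1}                          if b_{k+1} = a_{k+1}.
  -- (For k = 0 the second case never occurs since b_1 < a_1.)
  R : ℕ → Word
  R zero = false ∷ []
  R (suc zero) = R zero ++ ((M zero ^w (A 1 ∸ B 1 ∸ 1)) ++ M⁻ zero)
  R (suc (suc k)) =
    if B (suc (suc k)) <ᵇ A (suc (suc k))
    then R (suc k) ++ ((M (suc k) ^w (A (suc (suc k)) ∸ B (suc (suc k)) ∸ 1)) ++ M⁻ (suc k))
    else R k

  V : ℕ → Word
  V k = R k ++ T k

  ones : Word → ℕ
  ones [] = 0
  ones (true ∷ W) = suc (ones W)
  ones (false ∷ W) = ones W

module InField {c ℓ : Level} (F : Field c ℓ) where
  open Field F

  _^_ : Carrier → ℕ → Carrier
  x ^ zero = 1#
  x ^ suc n = x * (x ^ n)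

  _^ℤ_ : Carrier → ℤ → Carrier
  x ^ℤ (+ n) = x ^ n
  x ^ℤ -[1+ n ] = (x ^ suc n) ⁻¹

  _/_ : Carrier → Carrier → Carrier
  x / y = x * (y ⁻¹)

  Frac : Set c
  Frac = Carrier × Carrier

  _∸f_ : Frac → Frac → Frac
  (x , y) ∸f (x′ , y′) = (x - x′) , (y - y′)

  _≐_·_∔_ : Frac → Carrier → Frac → Frac → Set ℓ
  X ≐ γ · Y ∔ Z =
    (proj₁ X ≈ γ * proj₁ Y + proj₁ Z) × (proj₂ X ≈ γ * proj₂ Y + proj₂ Z)

  module Objects (A B : ℕ → ℕ) (a b : Carrier) where
    open Sturm A B

    letter : Bool → Carrier
    letter true = 1#
    letter false = 0#

    -- W(b,a) = Σ_n w_n b^{ℓ-n} a^{Σ_{h>n} w_h}, computed letter by letter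
    ev : Word → Carrier
    ev [] = 0#
    ev (w ∷ W) = letter w * (b ^ length W) * (a ^ ones W) + ev W

    mon : ℤ → ℤ → Carrier
    mon i j = (b ^ℤ i) * (a ^ℤ j)

    x : ℕ → Carrier
    x k = (b ^ q k) * (a ^ p k)

    f1 f2 f3 f4 : ℕ → Frac
    f1 k = ((b - 1#) * (ev (R (suc k)) - ev (R k))) ,
           (mon (r (suc k)) (r̃ (suc k)) - mon (r k) (r̃ k))
    f2 k = ((b - 1#) * ev (R (suc k) ++ T k)) ,
           (mon (r (suc k) ℤ.+ + t k) (r̃ (suc k) ℤ.+ + t̃ k) - 1#)
    f3 k = ((b - 1#) * (ev (R (suc k) ++ M k) - ev (R (suc k)))) ,
           (mon (r (suc k)) (r̃ (suc k)) * (x k - 1#))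
    f4 k = ((b - 1#) * ev (V (suc k))) , (x (suc k) - 1#)

    f3⁻ f4⁻ : ℕ → Frac
    f3⁻ zero = (b - 1#) , 0#
    f3⁻ (suc k) = f3 k
    f4⁻ zero = 0# , (b - 1#)
    f4⁻ (suc k) = f4 k

    cc : ℕ → Carrier
    cc zero = ((b ^ (A 1 ∸ B 1)) * a - b) / (b - 1#)
    cc (suc k) =
      (mon (r (suc k) ℤ.+ + q⁻ (suc k)) (r̃ (suc k) ℤ.+ + p⁻ (suc k))
        * ((x (suc k) ^ℤ (+ A (suc (suc k)) ℤ.- + B (suc (suc k)) ℤ.- + 1)) - 1#))
      / (x (suc k) - 1#)

    dd ee ff : ℕ → Carrier
    dd k = mon (+ t k) (+ t̃ k) - 1#
    ee k = mon (r k) (r̃ k) - 1#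
    ff k = (mon (+ t k) (+ t̃ k) * ((x k ^ B (suc k)) - 1#)) / (x k - 1#)

-- The combinatorial heart is the factorisation M_k = T_k R̂_k, where R̂_k follows the recursion of
-- R_k except that R̂_1 drops the leading letter 0 which R_1 inherits from R_0 = 0; R_k and R̂_k
-- differ at most by that letter, so R_k(b,a) = R̂_k(b,a).  The factorisation is proved by induction
-- along the recursions of M, T and R, the case b_{k+1} = a_{k+1} using b_k = 0.  Counting letters
-- gives |R̂_k| = r_k and |R̂_k|₁ = r̃_k, so b^{r_k} a^{r̃_k} is the weight b^{|R̂_k|} a^{|R̂_k|₁}, and
-- evaluating gives M_k(b,a) = b^{r_k} a^{r̃_k} T_k(b,a) + R_k(b,a).  Since
-- (UW)(b,a) = U(b,a) b^{|W|} a^{|W|₁} + W(b,a), every entry of (1)_k, …, (4)_k, and also c_k (k ≥ 1)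
-- and f_k, becomes an expression in a few quantities of levels k and k + 1 (c_k and f_k are
-- monomials times geometric sums, except c_k = -b^{r_{k-1}} a^{r̃_{k-1}} when b_{k+1} = a_{k+1}),
-- and each relation is a ring identity in these quantities.

module Submission where

open import Defs
open import Level using (Level)
open import Data.Nat using (ℕ)
open import Data.Product using (_×_)
open import Relation.Nullary using (¬_)

open import Algebra.Bundles using (CommutativeRing)
open import Data.Bool using (Bool; true; false; if_then_else_)
open import Data.Integer as ℤ using (ℤ; +_; -[1+_])
import Data.Integer.Properties as ℤ
open import Data.List using ([]; _∷_; [_]; _++_; length)
open import Data.List.Properties using (length-++; ++-assoc; ++-identityʳ)
open import Data.Nat as ℕ using (zero; suc; _∸_; _<ᵇ_)
import Data.Nat.Properties as ℕ
open import Data.Product using (_,_; proj₁; proj₂)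
open import Data.Sum using (_⊎_; [_,_]′)
open import Relation.Binary.PropositionalEquality as ≡ using (_≡_)

-- The standard library instantiates its ring solver with coefficients in ℕ, which has no negation,
-- or in the carrier itself, which needs decidable equality to cancel x - x; hence coefficients in ℤ.

module IntegerCoefficients {c ℓ : Level} (R : CommutativeRing c ℓ) where
  open CommutativeRing R
  open import Algebra.Properties.Ring ring using (-0#≈0#; -‿involutive; -‿+-comm; -‿distribˡ-*; -‿distribʳ-*)
  open import Algebra.Properties.CommutativeSemigroup +-commutativeSemigroup using (interchange)
  open import Algebra.Properties.Semiring.Mult.TCOptimised semiring
    using (1+×; ×-homo-+; ×1-homo-*) renaming (_×_ to _×′_)
  open import Algebra.Solver.Ring.AlmostCommutativeRing using (fromCommutativeRing; _-Raw-AlmostCommutative⟶_)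
  open import Data.Integer using (_⊖_)
  open import Data.Maybe using (Maybe; just; nothing)
  import Data.Sign as Sign
  open import Relation.Nullary using (yes; no)
  open import Relation.Binary.Reasoning.Setoid setoid

  fromℤ : ℤ → Carrier
  fromℤ (+ n)    = n ×′ 1#
  fromℤ -[1+ n ] = - (suc n ×′ 1#)

  fromℤ-homo-‿ : ∀ i → fromℤ (ℤ.- i) ≈ - fromℤ i
  fromℤ-homo-‿ (+ zero)  = sym -0#≈0#
  fromℤ-homo-‿ (+ suc n) = refl
  fromℤ-homo-‿ -[1+ n ]  = sym (-‿involutive _)

  fromℤ-homo-⊖ : ∀ m n → fromℤ (m ⊖ n) ≈ m ×′ 1# - n ×′ 1#
  fromℤ-homo-⊖ m zero = begin
    fromℤ (m ⊖ 0)      ≡⟨ ≡.cong fromℤ (ℤ.⊖-≥ {m} ℕ.z≤n) ⟩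
    m ×′ 1#            ≈⟨ +-identityʳ _ ⟨
    m ×′ 1# + 0#       ≈⟨ +-congˡ -0#≈0# ⟨
    m ×′ 1# - 0#       ∎
  fromℤ-homo-⊖ zero (suc n) = sym (+-identityˡ _)
  fromℤ-homo-⊖ (suc m) (suc n) = begin
    fromℤ (suc m ⊖ suc n)               ≡⟨ ≡.cong fromℤ (ℤ.[1+m]⊖[1+n]≡m⊖n m n) ⟩
    fromℤ (m ⊖ n)                       ≈⟨ fromℤ-homo-⊖ m n ⟩
    m ×′ 1# - n ×′ 1#                   ≈⟨ +-identityˡ _ ⟨
    0# + (m ×′ 1# - n ×′ 1#)            ≈⟨ +-congʳ (-‿inverseʳ 1#) ⟨
    (1# - 1#) + (m ×′ 1# - n ×′ 1#)     ≈⟨ interchange _ _ _ _ ⟩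
    (1# + m ×′ 1#) + (- 1# - n ×′ 1#)   ≈⟨ +-cong (1+× m 1#) (sym (-‿+-comm _ _)) ⟨
    suc m ×′ 1# - (1# + n ×′ 1#)        ≈⟨ +-congˡ (-‿cong (1+× n 1#)) ⟨
    suc m ×′ 1# - suc n ×′ 1#           ∎

  fromℤ-homo-+ : ∀ i j → fromℤ (i ℤ.+ j) ≈ fromℤ i + fromℤ j
  fromℤ-homo-+ (+ m)    (+ n)    = ×-homo-+ 1# m n
  fromℤ-homo-+ (+ m)    -[1+ n ] = fromℤ-homo-⊖ m (suc n)
  fromℤ-homo-+ -[1+ m ] (+ n)    = trans (fromℤ-homo-⊖ n (suc m)) (+-comm _ _)
  fromℤ-homo-+ -[1+ m ] -[1+ n ] = begin
    - (suc (suc (m ℕ.+ n)) ×′ 1#)       ≡⟨ ≡.cong (λ k → - (suc k ×′ 1#)) (ℕ.+-suc m n) ⟨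
    - ((suc m ℕ.+ suc n) ×′ 1#)         ≈⟨ -‿cong (×-homo-+ 1# (suc m) (suc n)) ⟩
    - (suc m ×′ 1# + suc n ×′ 1#)       ≈⟨ -‿+-comm _ _ ⟨
    - (suc m ×′ 1#) - suc n ×′ 1#       ∎

  fromℤ-homo-* : ∀ i j → fromℤ (i ℤ.* j) ≈ fromℤ i * fromℤ j
  fromℤ-homo-* (+ m) (+ n) = trans (reflexive (≡.cong fromℤ (ℤ.+◃n≡+n (m ℕ.* n)))) (×1-homo-* m n)
  fromℤ-homo-* (+ m) -[1+ n ] = begin
    fromℤ (Sign.- ℤ.◃ (m ℕ.* suc n))    ≡⟨ ≡.cong fromℤ (ℤ.-◃n≡-n (m ℕ.* suc n)) ⟩
    fromℤ (ℤ.- + (m ℕ.* suc n))         ≈⟨ fromℤ-homo-‿ (+ (m ℕ.* suc n)) ⟩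
    - ((m ℕ.* suc n) ×′ 1#)             ≈⟨ -‿cong (×1-homo-* m (suc n)) ⟩
    - (m ×′ 1# * suc n ×′ 1#)           ≈⟨ -‿distribʳ-* _ _ ⟩
    m ×′ 1# * - (suc n ×′ 1#)           ∎
  fromℤ-homo-* -[1+ m ] (+ n) = begin
    fromℤ (Sign.- ℤ.◃ (suc m ℕ.* n))    ≡⟨ ≡.cong fromℤ (ℤ.-◃n≡-n (suc m ℕ.* n)) ⟩
    fromℤ (ℤ.- + (suc m ℕ.* n))         ≈⟨ fromℤ-homo-‿ (+ (suc m ℕ.* n)) ⟩
    - ((suc m ℕ.* n) ×′ 1#)             ≈⟨ -‿cong (×1-homo-* (suc m) n) ⟩
    - (suc m ×′ 1# * n ×′ 1#)           ≈⟨ -‿distribˡ-* _ _ ⟩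
    - (suc m ×′ 1#) * n ×′ 1#           ∎
  fromℤ-homo-* -[1+ m ] -[1+ n ] = begin
    (suc m ℕ.* suc n) ×′ 1#             ≈⟨ ×1-homo-* (suc m) (suc n) ⟩
    suc m ×′ 1# * suc n ×′ 1#           ≈⟨ -‿involutive _ ⟨
    - - (suc m ×′ 1# * suc n ×′ 1#)     ≈⟨ -‿cong (-‿distribˡ-* _ _) ⟩
    - (- (suc m ×′ 1#) * suc n ×′ 1#)   ≈⟨ -‿distribʳ-* _ _ ⟩
    - (suc m ×′ 1#) * - (suc n ×′ 1#)   ∎

  homomorphism : ℤ.+-*-rawRing -Raw-AlmostCommutative⟶ fromCommutativeRing R
  homomorphism = record
    { ⟦_⟧    = fromℤ
    ; +-homo = fromℤ-homo-+
    ; *-homo = fromℤ-homo-*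
    ; -‿homo = fromℤ-homo-‿
    ; 0-homo = refl
    ; 1-homo = refl
    }

  _≟ᶻ_ : ∀ i j → Maybe (fromℤ i ≈ fromℤ j)
  i ≟ᶻ j with i ℤ.≟ j
  ... | yes ≡.refl = just refl
  ... | no _       = nothing

  open import Algebra.Solver.Ring ℤ.+-*-rawRing (fromCommutativeRing R) homomorphism _≟ᶻ_ public

  :0 :1 : ∀ {n} → Polynomial n
  :0 = con (+ 0)
  :1 = con (+ 1)

module Arithmetic where
  open import Data.Nat using (_+_; _≤_; _<_)
  open import Data.Nat.Properties
  open import Data.Empty using (⊥-elim)
  open import Data.Unit using (tt)
  open ≡ using (refl; sym; trans; cong)
  open ≡.≡-Reasoning

  if-<ᵇ-< : ∀ {a} {X : Set a} {m n} {x y : X} → m < n → (if m <ᵇ n then x else y) ≡ x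
  if-<ᵇ-< {m = m} {n} m<n with m <ᵇ n | <⇒<ᵇ m<n
  ... | true | _ = refl

  if-<ᵇ-≡ : ∀ {a} {X : Set a} {m n} {x y : X} → m ≡ n → (if m <ᵇ n then x else y) ≡ y
  if-<ᵇ-≡ {m = m} {n} m≡n with m <ᵇ n | <ᵇ⇒< m n
  ... | false | _   = refl
  ... | true  | m<n = ⊥-elim (<-irrefl m≡n (m<n tt))

  m<n⇒n≡m+[1+n∸m∸1] : ∀ {m n} → m < n → n ≡ m + suc (n ∸ m ∸ 1)
  m<n⇒n≡m+[1+n∸m∸1] {m} {n} m<n = sym (begin
    m + suc (n ∸ m ∸ 1)   ≡⟨ +-suc m _ ⟩
    suc m + (n ∸ m ∸ 1)   ≡⟨ cong (λ j → suc m + j) (trans (∸-+-assoc n m 1) (cong (n ∸_) (+-comm m 1))) ⟩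
    suc m + (n ∸ suc m)   ≡⟨ m+[n∸m]≡n m<n ⟩
    n                     ∎)

  +m-+n≡+[m∸n] : ∀ {m n} → n ≤ m → + m ℤ.- + n ≡ + (m ∸ n)
  +m-+n≡+[m∸n] {m} {n} n≤m = trans (ℤ.m-n≡m⊖n m n) (ℤ.⊖-≥ n≤m)

  +[m+n]-+m≡+n : ∀ m n → + (m + n) ℤ.- + m ≡ + n
  +[m+n]-+m≡+n m n = trans (+m-+n≡+[m∸n] (m≤m+n m n)) (cong +_ (m+n∸m≡n m n))

open Arithmetic

module WordProperties (A B : ℕ → ℕ) where
  open Sturm A B
  open import Data.Nat using (_+_; _*_)
  open ≡ using (refl; sym; trans; cong)

  ^w-+ : ∀ W m n → W ^w (m + n) ≡ (W ^w m) ++ (W ^w n)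
  ^w-+ W zero    n = refl
  ^w-+ W (suc m) n = trans (cong (W ++_) (^w-+ W m n)) (sym (++-assoc W (W ^w m) (W ^w n)))

  ones-++ : ∀ U W → ones (U ++ W) ≡ ones U + ones W
  ones-++ []          W = refl
  ones-++ (true ∷ U)  W = cong suc (ones-++ U W)
  ones-++ (false ∷ U) W = ones-++ U W

  ^w-homo : (h : Word → ℕ) → h [] ≡ 0 → (∀ U W → h (U ++ W) ≡ h U + h W) →
            ∀ W m → h (W ^w m) ≡ m * h W
  ^w-homo h h[]≡0 h-++ W zero    = h[]≡0
  ^w-homo h h[]≡0 h-++ W (suc m) = trans (h-++ W (W ^w m)) (cong (λ j → h W + j) (^w-homo h h[]≡0 h-++ W m))

  length-^w : ∀ W m → length (W ^w m) ≡ m * length W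
  length-^w = ^w-homo length refl (λ U W → length-++ U)

  ones-^w : ∀ W m → ones (W ^w m) ≡ m * ones W
  ones-^w = ^w-homo ones refl ones-++

module SturmWords (A B : ℕ → ℕ) (cf : CFDigits A) (os : OstrowskiDigits A B) where
  open Sturm A B
  open WordProperties A B public
  open import Data.Nat using (_+_; _*_; _<_; s≤s; z≤n)
  open import Data.Nat.Properties using (m≤n⇒m<n∨m≡n; +-∸-assoc; m∸n+n≡m; *-identityʳ; *-zeroʳ; +-comm)
  open ≡ using (refl; sym; trans; cong; cong₂)
  open ≡.≡-Reasoning

  first-digit : B 1 < A 1
  first-digit = proj₁ os

  digit-cases : ∀ k → B (2 + k) < A (2 + k) ⊎ B (2 + k) ≡ A (2 + k)
  digit-cases k = m≤n⇒m<n∨m≡n (proj₁ (proj₂ os) k)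

  full-digit⇒previous-zero : ∀ k → B (2 + k) ≡ A (2 + k) → B (1 + k) ≡ 0
  full-digit⇒previous-zero = proj₂ (proj₂ os)

  length-M : ∀ k → length (M k) ≡ q k
  length-M zero = refl
  length-M (suc zero) = begin
    length ((M 0 ^w (A 1 ∸ 1)) ++ [ true ])   ≡⟨ length-++ (M 0 ^w (A 1 ∸ 1)) ⟩
    length (M 0 ^w (A 1 ∸ 1)) + 1             ≡⟨ cong (_+ 1) (trans (length-^w (M 0) (A 1 ∸ 1)) (*-identityʳ _)) ⟩
    A 1 ∸ 1 + 1                               ≡⟨ m∸n+n≡m (cf 0) ⟩
    A 1                                       ∎
  length-M (suc (suc k)) = trans (length-++ (M (1 + k) ^w A (2 + k)))
    (cong₂ _+_ (trans (length-^w (M (1 + k)) (A (2 + k))) (cong (A (2 + k) *_) (length-M (suc k))))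
               (length-M k))

  ones-M : ∀ k → ones (M k) ≡ p k
  ones-M zero = refl
  ones-M (suc zero) = trans (ones-++ (M 0 ^w (A 1 ∸ 1)) [ true ])
    (cong (_+ 1) (trans (ones-^w (M 0) (A 1 ∸ 1)) (*-zeroʳ (A 1 ∸ 1))))
  ones-M (suc (suc k)) = trans (ones-++ (M (1 + k) ^w A (2 + k)) (M k))
    (cong₂ _+_ (trans (ones-^w (M (1 + k)) (A (2 + k))) (cong (A (2 + k) *_) (ones-M (suc k))))
               (ones-M k))

  length-T : ∀ k → length (T k) ≡ t k
  length-T zero = refl
  length-T (suc k) = trans (length-++ (M k ^w B (1 + k)))
    (trans (cong₂ _+_ (trans (length-^w (M k) (B (1 + k))) (cong (B (1 + k) *_) (length-M k))) (length-T k))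
           (+-comm _ (t k)))

  ones-T : ∀ k → ones (T k) ≡ t̃ k
  ones-T zero = refl
  ones-T (suc k) = trans (ones-++ (M k ^w B (1 + k)) (T k))
    (trans (cong₂ _+_ (trans (ones-^w (M k) (B (1 + k))) (cong (B (1 + k) *_) (ones-M k))) (ones-T k))
           (+-comm _ (t̃ k)))

  T-zero-digit : ∀ k → B (1 + k) ≡ 0 → T (1 + k) ≡ T k
  T-zero-digit k b≡0 = cong (λ m → (M k ^w m) ++ T k) b≡0

  gap : ℕ → ℕ
  gap k = A (2 + k) ∸ B (2 + k) ∸ 1

  extension : ℕ → Word
  extension k = (M (1 + k) ^w gap k) ++ M k

  R̂ : ℕ → Word
  R̂ zero          = M 0
  R̂ (suc zero)    = (M 0 ^w (A 1 ∸ B 1 ∸ 1)) ++ M⁻ 0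
  R̂ (suc (suc k)) = if B (2 + k) <ᵇ A (2 + k) then R̂ (suc k) ++ extension k else R̂ k

  R̂-< : ∀ k → B (2 + k) < A (2 + k) → R̂ (2 + k) ≡ R̂ (1 + k) ++ extension k
  R̂-< k = if-<ᵇ-<

  R̂-≡ : ∀ k → B (2 + k) ≡ A (2 + k) → R̂ (2 + k) ≡ R̂ k
  R̂-≡ k = if-<ᵇ-≡

  M≡T++R̂ : ∀ k → M k ≡ T k ++ R̂ k
  M≡T++R̂ zero = refl
  M≡T++R̂ (suc zero) = begin
    (M 0 ^w (A 1 ∸ 1)) ++ [ true ]             ≡⟨ cong (λ m → (M 0 ^w m) ++ [ true ]) a₁∸1≡b₁+n ⟩
    (M 0 ^w (B 1 + n)) ++ [ true ]             ≡⟨ cong (_++ [ true ]) (^w-+ (M 0) (B 1) n) ⟩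
    ((M 0 ^w B 1) ++ (M 0 ^w n)) ++ [ true ]   ≡⟨ ++-assoc (M 0 ^w B 1) _ _ ⟩
    (M 0 ^w B 1) ++ ((M 0 ^w n) ++ [ true ])   ≡⟨ cong (_++ R̂ 1) (++-identityʳ (M 0 ^w B 1)) ⟨
    ((M 0 ^w B 1) ++ []) ++ R̂ 1                ∎
    where
    n = A 1 ∸ B 1 ∸ 1
    a₁∸1≡b₁+n : A 1 ∸ 1 ≡ B 1 + n
    a₁∸1≡b₁+n = trans (cong (_∸ 1) (m<n⇒n≡m+[1+n∸m∸1] first-digit)) (+-∸-assoc (B 1) {suc n} {1} (s≤s z≤n))
  M≡T++R̂ (suc (suc k)) = [ case-< (M≡T++R̂ (suc k)) , case-≡ (M≡T++R̂ k) ]′ (digit-cases k)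
    where
    M′ = M (1 + k)

    case-< : M′ ≡ T (1 + k) ++ R̂ (1 + k) → B (2 + k) < A (2 + k) → M (2 + k) ≡ T (2 + k) ++ R̂ (2 + k)
    case-< ih b<a = begin
      (M′ ^w A (2 + k)) ++ M k
        ≡⟨ cong (λ m → (M′ ^w m) ++ M k) (m<n⇒n≡m+[1+n∸m∸1] b<a) ⟩
      (M′ ^w (B (2 + k) + suc (gap k))) ++ M k
        ≡⟨ cong (_++ M k) (^w-+ M′ (B (2 + k)) (suc (gap k))) ⟩
      ((M′ ^w B (2 + k)) ++ (M′ ++ (M′ ^w gap k))) ++ M k
        ≡⟨ ++-assoc (M′ ^w B (2 + k)) _ _ ⟩
      (M′ ^w B (2 + k)) ++ ((M′ ++ (M′ ^w gap k)) ++ M k)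
        ≡⟨ cong (M′ ^w B (2 + k) ++_) (++-assoc M′ _ _) ⟩
      (M′ ^w B (2 + k)) ++ (M′ ++ extension k)
        ≡⟨ cong (λ W → M′ ^w B (2 + k) ++ (W ++ extension k)) ih ⟩
      (M′ ^w B (2 + k)) ++ ((T (1 + k) ++ R̂ (1 + k)) ++ extension k)
        ≡⟨ cong (M′ ^w B (2 + k) ++_) (++-assoc (T (1 + k)) _ _) ⟩
      (M′ ^w B (2 + k)) ++ (T (1 + k) ++ (R̂ (1 + k) ++ extension k))
        ≡⟨ ++-assoc (M′ ^w B (2 + k)) _ _ ⟨
      T (2 + k) ++ (R̂ (1 + k) ++ extension k)
        ≡⟨ cong (T (2 + k) ++_) (R̂-< k b<a) ⟨
      T (2 + k) ++ R̂ (2 + k)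
        ∎

    case-≡ : M k ≡ T k ++ R̂ k → B (2 + k) ≡ A (2 + k) → M (2 + k) ≡ T (2 + k) ++ R̂ (2 + k)
    case-≡ ih b≡a = begin
      (M′ ^w A (2 + k)) ++ M k                 ≡⟨ cong ((M′ ^w A (2 + k)) ++_) ih ⟩
      (M′ ^w A (2 + k)) ++ (T k ++ R̂ k)        ≡⟨ ++-assoc (M′ ^w A (2 + k)) _ _ ⟨
      ((M′ ^w A (2 + k)) ++ T k) ++ R̂ k        ≡⟨ cong₂ (λ m W → ((M′ ^w m) ++ W) ++ R̂ k) (sym b≡a)
                                                          (sym (T-zero-digit k (full-digit⇒previous-zero k b≡a))) ⟩
      T (2 + k) ++ R̂ k                         ≡⟨ cong (T (2 + k) ++_) (R̂-≡ k b≡a) ⟨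
      T (2 + k) ++ R̂ (2 + k)                   ∎

  q≡t+length-R̂ : ∀ k → q k ≡ t k + length (R̂ k)
  q≡t+length-R̂ k = begin
    q k                           ≡⟨ length-M k ⟨
    length (M k)                  ≡⟨ cong length (M≡T++R̂ k) ⟩
    length (T k ++ R̂ k)           ≡⟨ length-++ (T k) ⟩
    length (T k) + length (R̂ k)   ≡⟨ cong (_+ length (R̂ k)) (length-T k) ⟩
    t k + length (R̂ k)            ∎

  p≡t̃+ones-R̂ : ∀ k → p k ≡ t̃ k + ones (R̂ k)
  p≡t̃+ones-R̂ k = begin
    p k                           ≡⟨ ones-M k ⟨
    ones (M k)                    ≡⟨ cong ones (M≡T++R̂ k) ⟩
    ones (T k ++ R̂ k)             ≡⟨ ones-++ (T k) (R̂ k) ⟩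
    ones (T k) + ones (R̂ k)       ≡⟨ cong (_+ ones (R̂ k)) (ones-T k) ⟩
    t̃ k + ones (R̂ k)              ∎

  r≡length-R̂ : ∀ k → r k ≡ + length (R̂ k)
  r≡length-R̂ k = trans (cong (λ n → + n ℤ.- + t k) (q≡t+length-R̂ k)) (+[m+n]-+m≡+n (t k) _)

  r̃≡ones-R̂ : ∀ k → r̃ k ≡ + ones (R̂ k)
  r̃≡ones-R̂ k = trans (cong (λ n → + n ℤ.- + t̃ k) (p≡t̃+ones-R̂ k)) (+[m+n]-+m≡+n (t̃ k) _)

module FieldProperties {c ℓ : Level} (F : Field c ℓ) where
  open Field F
  open InField F
  open IntegerCoefficients commutativeRing using (solve; _:=_; _:+_; _:*_; _:-_; :-_; :0; :1)
  open import Relation.Binary.Reasoning.Setoid setoid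

  ^-+ : ∀ y m n → y ^ (m ℕ.+ n) ≈ y ^ m * y ^ n
  ^-+ y zero    n = sym (*-identityˡ _)
  ^-+ y (suc m) n = trans (*-congˡ (^-+ y m n)) (sym (*-assoc _ _ _))

  geom : Carrier → ℕ → Carrier
  geom y zero    = 0#
  geom y (suc m) = y ^ m + geom y m

  geom-telescope : ∀ y m → (y - 1#) * geom y m + 1# ≈ y ^ m
  geom-telescope y zero = solve 1 (λ y → (y :- :1) :* :0 :+ :1 := :1) refl y
  geom-telescope y (suc m) = begin
    (y - 1#) * (y ^ m + geom y m) + 1#
      ≈⟨ solve 3 (λ y Y G → (y :- :1) :* (Y :+ G) :+ :1 := (y :- :1) :* Y :+ ((y :- :1) :* G :+ :1))
                 refl y (y ^ m) (geom y m) ⟩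
    (y - 1#) * y ^ m + ((y - 1#) * geom y m + 1#)    ≈⟨ +-congˡ (geom-telescope y m) ⟩
    (y - 1#) * y ^ m + y ^ m                         ≈⟨ solve 2 (λ y Y → (y :- :1) :* Y :+ Y := y :* Y) refl y (y ^ m) ⟩
    y * y ^ m                                        ∎

  x≉1⇒x-1≉0 : ∀ {y} → ¬ (y ≈ 1#) → ¬ (y - 1# ≈ 0#)
  x≉1⇒x-1≉0 {y} y≉1 y-1≈0 = y≉1 (begin
    y                ≈⟨ solve 1 (λ y → y := (y :- :1) :+ :1) refl y ⟩
    (y - 1#) + 1#    ≈⟨ +-congʳ y-1≈0 ⟩
    0# + 1#          ≈⟨ +-identityˡ 1# ⟩
    1#               ∎)

  *-≉0 : ∀ {y z} → ¬ (y ≈ 0#) → ¬ (z ≈ 0#) → ¬ (y * z ≈ 0#)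
  *-≉0 {y} {z} y≉0 z≉0 yz≈0 = z≉0 (begin
    z                ≈⟨ *-identityˡ z ⟨
    1# * z           ≈⟨ *-congʳ (trans (*-comm _ _) (⁻¹-inverse y y≉0)) ⟨
    (y ⁻¹ * y) * z   ≈⟨ *-assoc _ _ _ ⟩
    y ⁻¹ * (y * z)   ≈⟨ *-congˡ yz≈0 ⟩
    y ⁻¹ * 0#        ≈⟨ zeroʳ _ ⟩
    0#               ∎)

  ^-≉0 : ∀ {y} → ¬ (y ≈ 0#) → ∀ n → ¬ (y ^ n ≈ 0#)
  ^-≉0 y≉0 zero    1≈0 = 0≉1 (sym 1≈0)
  ^-≉0 y≉0 (suc n)     = *-≉0 y≉0 (^-≉0 y≉0 n)

  /-unique : ∀ {u v w} → ¬ (w ≈ 0#) → u ≈ v * w → u / w ≈ v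
  /-unique {u} {v} {w} w≉0 u≈vw = begin
    u * w ⁻¹         ≈⟨ *-congʳ u≈vw ⟩
    (v * w) * w ⁻¹   ≈⟨ *-assoc _ _ _ ⟩
    v * (w * w ⁻¹)   ≈⟨ *-congˡ (⁻¹-inverse w w≉0) ⟩
    v * 1#           ≈⟨ *-identityʳ v ⟩
    v                ∎

  /-*-cancel : ∀ {u w} → ¬ (w ≈ 0#) → (u / w) * w ≈ u
  /-*-cancel {u} {w} w≉0 = begin
    (u * w ⁻¹) * w   ≈⟨ *-assoc _ _ _ ⟩
    u * (w ⁻¹ * w)   ≈⟨ *-congˡ (trans (*-comm _ _) (⁻¹-inverse w w≉0)) ⟩
    u * 1#           ≈⟨ *-identityʳ u ⟩
    u                ∎

  geom-quotient : ∀ {y} z m → ¬ (y ≈ 1#) → (z * (y ^ m - 1#)) / (y - 1#) ≈ z * geom y m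
  geom-quotient {y} z m y≉1 = /-unique (x≉1⇒x-1≉0 y≉1) (begin
    z * (y ^ m - 1#)                        ≈⟨ *-congˡ (+-congʳ (geom-telescope y m)) ⟨
    z * (((y - 1#) * geom y m + 1#) - 1#)   ≈⟨ solve 3 (λ z y G → z :* (((y :- :1) :* G :+ :1) :- :1) := z :* G :* (y :- :1))
                                                      refl z y (geom y m) ⟩
    z * geom y m * (y - 1#)                 ∎)

  inverse-quotient : ∀ {y} z → ¬ (y ≈ 0#) → ¬ (y ≈ 1#) →
                     ((z * y) * ((y ^ℤ -[1+ 0 ]) - 1#)) / (y - 1#) ≈ - z
  inverse-quotient {y} z y≉0 y≉1 = /-unique (x≉1⇒x-1≉0 y≉1) (begin
    (z * y) * (w - 1#)           ≈⟨ solve 3 (λ z y w → (z :* y) :* (w :- :1) := z :* ((y :* :1) :* w) :- z :* y) refl z y w ⟩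
    z * ((y * 1#) * w) - z * y   ≈⟨ +-congʳ (*-congˡ (⁻¹-inverse (y * 1#) (^-≉0 y≉0 1))) ⟩
    z * 1# - z * y               ≈⟨ solve 2 (λ z y → z :* :1 :- z :* y := (:- z) :* (y :- :1)) refl z y ⟩
    - z * (y - 1#)               ∎)
    where w = (y ^ 1) ⁻¹

module FormalFractions {c ℓ : Level} (F : Field c ℓ) where
  open Field F
  open InField F
  open IntegerCoefficients commutativeRing using (solve; _:=_; _:+_; _:*_; _:-_; :-_; :0; :1)

  _≋_ : Frac → Frac → Set ℓ
  X ≋ Y = (proj₁ X ≈ proj₁ Y) × (proj₂ X ≈ proj₂ Y)

  ≋-refl : ∀ {X} → X ≋ X
  ≋-refl = refl , refl

  ≋-trans : ∀ {X Y Z} → X ≋ Y → Y ≋ Z → X ≋ Z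
  ≋-trans (x₁ , x₂) (y₁ , y₂) = trans x₁ y₁ , trans x₂ y₂

  ∸f-cong : ∀ {X X′ Y Y′} → X ≋ X′ → Y ≋ Y′ → (X ∸f Y) ≋ (X′ ∸f Y′)
  ∸f-cong {_ , _} {_ , _} {_ , _} {_ , _} (x₁ , x₂) (y₁ , y₂) = +-cong x₁ (-‿cong y₁) , +-cong x₂ (-‿cong y₂)

  ≐-resp : ∀ {X X′ Y Y′ Z Z′ γ γ′} → X ≋ X′ → γ ≈ γ′ → Y ≋ Y′ → Z ≋ Z′ →
           X′ ≐ γ′ · Y′ ∔ Z′ → X ≐ γ · Y ∔ Z
  ≐-resp (x₁ , x₂) γ≈γ′ (y₁ , y₂) (z₁ , z₂) (e₁ , e₂) =
    trans x₁ (trans e₁ (sym (+-cong (*-cong γ≈γ′ y₁) z₁))) ,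
    trans x₂ (trans e₂ (sym (+-cong (*-cong γ≈γ′ y₂) z₂)))

  ∸f-split : ∀ X Y → X ≐ 1# · (X ∸f Y) ∔ Y
  ∸f-split (x , y) (x′ , y′) = split x x′ , split y y′
    where
    split : ∀ u v → u ≈ 1# * (u - v) + v
    split = solve 2 (λ u v → u := :1 :* (u :- v) :+ v) refl

  -- The parameters stand for b - 1, R_k(b,a), R_{k+1}(b,a), T_k(b,a), b^{t_k} a^{t̃_k},
  -- b^{r_k} a^{r̃_k} and b^{r_{k+1}} a^{r̃_{k+1}}; F₁ and F₂ are (1)_k and (2)_k.
  module Skeleton (β e₀ e₁ τ D ρ₀ ρ₁ : Carrier) where
    F₁ F₂ : Frac
    F₁ = (β * (e₁ - e₀) , ρ₁ - ρ₀)
    F₂ = (β * (e₁ * D + τ) , ρ₁ * D - 1#)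

    rel2 : ∀ {X} → X ≈ ρ₀ * D → (F₂ ∸f F₁) ≐ (D - 1#) · F₁ ∔ (β * (e₀ * D + τ) , X - 1#)
    rel2 X≈ρ₀D = ≐-resp ≋-refl refl ≋-refl (refl , +-congʳ X≈ρ₀D)
      ( solve 5 (λ β e₀ e₁ τ D →
          β :* (e₁ :* D :+ τ) :- β :* (e₁ :- e₀) := (D :- :1) :* (β :* (e₁ :- e₀)) :+ β :* (e₀ :* D :+ τ))
          refl β e₀ e₁ τ D
      , solve 3 (λ D ρ₀ ρ₁ →
          (ρ₁ :* D :- :1) :- (ρ₁ :- ρ₀) := (D :- :1) :* (ρ₁ :- ρ₀) :+ (ρ₀ :* D :- :1))
          refl D ρ₀ ρ₁ )

    rel4 : ∀ {X μ} → X ≈ ρ₀ * D → μ ≈ ρ₀ * τ + e₀ →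
           (β * ((e₁ * X + μ) - e₁) , ρ₁ * (X - 1#)) ≐ (ρ₀ - 1#) · F₂ ∔ (F₂ ∸f F₁)
    rel4 X≈ρ₀D μ≈ = ≐-resp (*-congˡ (+-congʳ (+-cong (*-congˡ X≈ρ₀D) μ≈)) , *-congˡ (+-congʳ X≈ρ₀D))
                           refl ≋-refl ≋-refl
      ( solve 6 (λ β e₀ e₁ τ D ρ₀ →
          β :* ((e₁ :* (ρ₀ :* D) :+ (ρ₀ :* τ :+ e₀)) :- e₁)
            := (ρ₀ :- :1) :* (β :* (e₁ :* D :+ τ)) :+ (β :* (e₁ :* D :+ τ) :- β :* (e₁ :- e₀)))
          refl β e₀ e₁ τ D ρ₀
      , solve 3 (λ D ρ₀ ρ₁ →
          ρ₁ :* (ρ₀ :* D :- :1) := (ρ₀ :- :1) :* (ρ₁ :* D :- :1) :+ ((ρ₁ :* D :- :1) :- (ρ₁ :- ρ₀)))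
          refl D ρ₀ ρ₁ )

    rel5 : ∀ {X μ G D′ τ′ X′} →
           X′ ≈ ρ₁ * D′ → D′ ≈ ((X - 1#) * G + 1#) * D → τ′ ≈ μ * G * D + τ →
           (β * (e₁ * D′ + τ′) , X′ - 1#) ≐ (D * G) · (β * ((e₁ * X + μ) - e₁) , ρ₁ * (X - 1#)) ∔ F₂
    rel5 {X} {μ} {G} X′≈ D′≈ τ′≈ =
      ≐-resp (*-congˡ (+-cong (*-congˡ D′≈) τ′≈) , +-congʳ (trans X′≈ (*-congˡ D′≈))) refl ≋-refl ≋-refl
      ( solve 7 (λ β e₁ τ D X μ G →
          β :* (e₁ :* (((X :- :1) :* G :+ :1) :* D) :+ (μ :* G :* D :+ τ))
            := (D :* G) :* (β :* ((e₁ :* X :+ μ) :- e₁)) :+ β :* (e₁ :* D :+ τ))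
          refl β e₁ τ D X μ G
      , solve 4 (λ D ρ₁ X G →
          ρ₁ :* (((X :- :1) :* G :+ :1) :* D) :- :1 := (D :* G) :* (ρ₁ :* (X :- :1)) :+ (ρ₁ :* D :- :1))
          refl D ρ₁ X G )

  rel1-zero-skeleton : ∀ {β e₀ e₁ ρ₀ ρ₁ γ} → e₁ ≈ 1# → e₀ ≈ 0# → γ * β ≈ ρ₁ - ρ₀ →
                       (β * (e₁ - e₀) , ρ₁ - ρ₀) ≐ γ · (0# , β) ∔ (β , 0#)
  rel1-zero-skeleton {β} {γ = γ} e₁≈1 e₀≈0 γβ≈ρ₁-ρ₀ =
    ≐-resp (*-congˡ (+-cong e₁≈1 (-‿cong e₀≈0)) , refl) refl ≋-refl ≋-refl
      ( solve 2 (λ β γ → β :* (:1 :- :0) := γ :* :0 :+ β) refl β γ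
      , trans (sym γβ≈ρ₁-ρ₀) (sym (+-identityʳ _)) )

  rel1-<-skeleton : ∀ {β e e′ τ D ρ ρ′ X Xⱼ μ μⱼ G P} →
    e′ ≈ e * (P * Xⱼ) + (μ * G * Xⱼ + μⱼ) → ρ′ ≈ P * Xⱼ * ρ → P ≈ (X - 1#) * G + 1# →
    μ ≈ ρ * τ + e → X ≈ ρ * D →
    (β * (e′ - e) , ρ′ - ρ)
      ≐ (ρ * Xⱼ * G) · (β * (e * D + τ) , X - 1#) ∔ (β * ((e * Xⱼ + μⱼ) - e) , ρ * (Xⱼ - 1#))
  rel1-<-skeleton {β} {e} {_} {τ} {D} {ρ} {_} {_} {Xⱼ} {_} {μⱼ} {G} {P} e′≈ ρ′≈ P≈ μ≈ X≈ρD =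
    ≐-resp (*-congˡ (+-congʳ (trans e′≈ (+-cong (*-congˡ (*-congʳ P≈′)) (+-congʳ (*-congʳ (*-congʳ μ≈)))))) ,
            +-congʳ (trans ρ′≈ (*-congʳ (*-congʳ P≈′))))
           refl (refl , +-congʳ X≈ρD) ≋-refl
      ( solve 8 (λ β e τ D ρ Xⱼ μⱼ G →
          β :* ((e :* ((((ρ :* D) :- :1) :* G :+ :1) :* Xⱼ) :+ ((ρ :* τ :+ e) :* G :* Xⱼ :+ μⱼ)) :- e)
            := (ρ :* Xⱼ :* G) :* (β :* (e :* D :+ τ)) :+ β :* ((e :* Xⱼ :+ μⱼ) :- e))
          refl β e τ D ρ Xⱼ μⱼ G
      , solve 4 (λ D ρ Xⱼ G →
          (((ρ :* D) :- :1) :* G :+ :1) :* Xⱼ :* ρ :- ρ := (ρ :* Xⱼ :* G) :* ((ρ :* D) :- :1) :+ ρ :* (Xⱼ :- :1))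
          refl D ρ Xⱼ G )
    where
    P≈′ : P ≈ (ρ * D - 1#) * G + 1#
    P≈′ = trans P≈ (+-congʳ (*-congʳ (+-congʳ X≈ρD)))

  rel1-≡-skeleton : ∀ {β e e′ τ D ρ ρ′ X Xⱼ μⱼ} →
    X ≈ ρ * D → Xⱼ ≈ ρ′ * D → μⱼ ≈ ρ′ * τ + e′ →
    (β * (e′ - e) , ρ′ - ρ)
      ≐ (- ρ′) · (β * (e * D + τ) , X - 1#) ∔ (β * ((e * Xⱼ + μⱼ) - e) , ρ * (Xⱼ - 1#))
  rel1-≡-skeleton {β} {e} {e′} {τ} {D} {ρ} {ρ′} X≈ρD Xⱼ≈ρ′D μⱼ≈ =
    ≐-resp ≋-refl refl (refl , +-congʳ X≈ρD)
           (*-congˡ (+-congʳ (+-cong (*-congˡ Xⱼ≈ρ′D) μⱼ≈)) , *-congˡ (+-congʳ Xⱼ≈ρ′D))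
      ( solve 6 (λ β e e′ τ D ρ′ →
          β :* (e′ :- e) := (:- ρ′) :* (β :* (e :* D :+ τ)) :+ β :* ((e :* (ρ′ :* D) :+ (ρ′ :* τ :+ e′)) :- e))
          refl β e e′ τ D ρ′
      , solve 3 (λ D ρ ρ′ → ρ′ :- ρ := (:- ρ′) :* (ρ :* D :- :1) :+ ρ :* (ρ′ :* D :- :1)) refl D ρ ρ′ )

module Evaluation {c ℓ : Level} (F : Field c ℓ) (A B : ℕ → ℕ) (cf : CFDigits A) (os : OstrowskiDigits A B)
                  (a b : Field.Carrier F) where
  open Field F
  open InField F
  open Sturm A B
  open Objects A B a b
  open FieldProperties F
  open SturmWords A B cf os
  open IntegerCoefficients commutativeRing using (solve; _:=_; _:+_; _:*_)
  open import Algebra.Properties.CommutativeSemigroup *-commutativeSemigroup using (interchange)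
  open import Relation.Binary.Reasoning.Setoid setoid

  mono : ℕ → ℕ → Carrier
  mono m n = (b ^ m) * (a ^ n)

  weight : Word → Carrier
  weight W = mono (length W) (ones W)

  xᵀ xᴿ : ℕ → Carrier
  xᵀ k = mono (t k) (t̃ k)
  xᴿ k = mon (r k) (r̃ k)

  mono-+ : ∀ m m′ n n′ → mono (m ℕ.+ m′) (n ℕ.+ n′) ≈ mono m n * mono m′ n′
  mono-+ m m′ n n′ = trans (*-cong (^-+ b m m′) (^-+ a n n′)) (interchange _ _ _ _)

  weight-++ : ∀ U W → weight (U ++ W) ≈ weight U * weight W
  weight-++ U W = trans (reflexive (≡.cong₂ mono (length-++ U) (ones-++ U W)))
                        (mono-+ (length U) (length W) (ones U) (ones W))

  ev-++ : ∀ U W → ev (U ++ W) ≈ ev U * weight W + ev W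
  ev-++ [] W = sym (trans (+-congʳ (zeroˡ _)) (+-identityˡ _))
  ev-++ (u ∷ U) W = begin
    letter u * b ^ length (U ++ W) * a ^ ones (U ++ W) + ev (U ++ W)
      ≈⟨ +-cong (trans (*-assoc _ _ _) (*-congˡ (weight-++ U W))) (ev-++ U W) ⟩
    letter u * (weight U * weight W) + (ev U * weight W + ev W)
      ≈⟨ solve 6 (λ l bU aU w e e′ → l :* ((bU :* aU) :* w) :+ (e :* w :+ e′) := (l :* bU :* aU :+ e) :* w :+ e′)
               refl (letter u) (b ^ length U) (a ^ ones U) (weight W) (ev U) (ev W) ⟩
    (letter u * b ^ length U * a ^ ones U + ev U) * weight W + ev W
      ∎

  weight-^w : ∀ W m → weight (W ^w m) ≈ weight W ^ m
  weight-^w W zero    = *-identityˡ 1#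
  weight-^w W (suc m) = trans (weight-++ W (W ^w m)) (*-congˡ (weight-^w W m))

  ev-^w : ∀ W m → ev (W ^w m) ≈ ev W * geom (weight W) m
  ev-^w W zero    = sym (zeroʳ _)
  ev-^w W (suc m) = begin
    ev (W ++ (W ^w m))                               ≈⟨ ev-++ W (W ^w m) ⟩
    ev W * weight (W ^w m) + ev (W ^w m)             ≈⟨ +-cong (*-congˡ (weight-^w W m)) (ev-^w W m) ⟩
    ev W * weight W ^ m + ev W * geom (weight W) m   ≈⟨ distribˡ _ _ _ ⟨
    ev W * (weight W ^ m + geom (weight W) m)        ∎

  ev-0∷ : ∀ W → ev (false ∷ W) ≈ ev W
  ev-0∷ W = trans (+-congʳ (trans (*-congʳ (zeroˡ _)) (zeroˡ _))) (+-identityˡ _)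

  ev-0ⁿ++ : ∀ n W → ev ((M 0 ^w n) ++ W) ≈ ev W
  ev-0ⁿ++ zero    W = refl
  ev-0ⁿ++ (suc n) W = trans (ev-0∷ ((M 0 ^w n) ++ W)) (ev-0ⁿ++ n W)

  ev-R≈ev-R̂ : ∀ k → ev (R k) ≈ ev (R̂ k)
  ev-R≈ev-R̂ zero          = refl
  ev-R≈ev-R̂ (suc zero)    = ev-0∷ (R̂ 1)
  ev-R≈ev-R̂ (suc (suc k)) = by-digit (B (2 ℕ.+ k) <ᵇ A (2 ℕ.+ k)) (ev-R≈ev-R̂ (suc k)) (ev-R≈ev-R̂ k)
    where
    by-digit : ∀ d → ev (R (suc k)) ≈ ev (R̂ (suc k)) → ev (R k) ≈ ev (R̂ k) →
               ev (if d then R (suc k) ++ extension k else R k) ≈ ev (if d then R̂ (suc k) ++ extension k else R̂ k)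
    by-digit true  ih₁ _   = trans (ev-++ (R (suc k)) (extension k))
                                   (trans (+-congʳ (*-congʳ ih₁)) (sym (ev-++ (R̂ (suc k)) (extension k))))
    by-digit false _   ih₀ = ih₀

  weight-M : ∀ k → weight (M k) ≡ x k
  weight-M k = ≡.cong₂ mono (length-M k) (ones-M k)

  weight-T : ∀ k → weight (T k) ≡ xᵀ k
  weight-T k = ≡.cong₂ mono (length-T k) (ones-T k)

  weight-R̂ : ∀ k → weight (R̂ k) ≡ xᴿ k
  weight-R̂ k = ≡.sym (≡.cong₂ mon (r≡length-R̂ k) (r̃≡ones-R̂ k))

  ev-++-T : ∀ W k → ev (W ++ T k) ≈ ev W * xᵀ k + ev (T k)
  ev-++-T W k = trans (ev-++ W (T k)) (+-congʳ (*-congˡ (reflexive (weight-T k))))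

  ev-++-M : ∀ W k → ev (W ++ M k) ≈ ev W * x k + ev (M k)
  ev-++-M W k = trans (ev-++ W (M k)) (+-congʳ (*-congˡ (reflexive (weight-M k))))

  mon-shift : ∀ k m n → mon (r k ℤ.+ + m) (r̃ k ℤ.+ + n) ≈ xᴿ k * mono m n
  mon-shift k m n = begin
    mon (r k ℤ.+ + m) (r̃ k ℤ.+ + n)
      ≡⟨ ≡.cong₂ (λ i j → mon (i ℤ.+ + m) (j ℤ.+ + n)) (r≡length-R̂ k) (r̃≡ones-R̂ k) ⟩
    mono (length (R̂ k) ℕ.+ m) (ones (R̂ k) ℕ.+ n)   ≈⟨ mono-+ (length (R̂ k)) m (ones (R̂ k)) n ⟩
    weight (R̂ k) * mono m n                        ≡⟨ ≡.cong (_* mono m n) (weight-R̂ k) ⟩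
    xᴿ k * mono m n                                ∎

  x≈xᴿxᵀ : ∀ k → x k ≈ xᴿ k * xᵀ k
  x≈xᴿxᵀ k = begin
    x k                           ≡⟨ ≡.trans (≡.sym (weight-M k)) (≡.cong weight (M≡T++R̂ k)) ⟩
    weight (T k ++ R̂ k)           ≈⟨ weight-++ (T k) (R̂ k) ⟩
    weight (T k) * weight (R̂ k)   ≈⟨ *-comm _ _ ⟩
    weight (R̂ k) * weight (T k)   ≡⟨ ≡.cong₂ _*_ (weight-R̂ k) (weight-T k) ⟩
    xᴿ k * xᵀ k                   ∎

  ev-M : ∀ k → ev (M k) ≈ xᴿ k * ev (T k) + ev (R k)
  ev-M k = begin
    ev (M k)                             ≡⟨ ≡.cong ev (M≡T++R̂ k) ⟩
    ev (T k ++ R̂ k)                      ≈⟨ ev-++ (T k) (R̂ k) ⟩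
    ev (T k) * weight (R̂ k) + ev (R̂ k)   ≈⟨ +-cong (*-comm _ _) (sym (ev-R≈ev-R̂ k)) ⟩
    weight (R̂ k) * ev (T k) + ev (R k)   ≡⟨ ≡.cong (λ w → w * ev (T k) + ev (R k)) (weight-R̂ k) ⟩
    xᴿ k * ev (T k) + ev (R k)           ∎

  xᵀ-suc : ∀ k → xᵀ (suc k) ≈ x k ^ B (suc k) * xᵀ k
  xᵀ-suc k = begin
    xᵀ (suc k)                                 ≡⟨ weight-T (suc k) ⟨
    weight ((M k ^w B (suc k)) ++ T k)         ≈⟨ weight-++ (M k ^w B (suc k)) (T k) ⟩
    weight (M k ^w B (suc k)) * weight (T k)   ≈⟨ *-congʳ (weight-^w (M k) (B (suc k))) ⟩
    weight (M k) ^ B (suc k) * weight (T k)    ≡⟨ ≡.cong₂ (λ y z → y ^ B (suc k) * z) (weight-M k) (weight-T k) ⟩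
    x k ^ B (suc k) * xᵀ k                     ∎

  ev-T-suc : ∀ k → ev (T (suc k)) ≈ ev (M k) * geom (x k) (B (suc k)) * xᵀ k + ev (T k)
  ev-T-suc k = begin
    ev ((M k ^w B (suc k)) ++ T k)                         ≈⟨ ev-++-T (M k ^w B (suc k)) k ⟩
    ev (M k ^w B (suc k)) * xᵀ k + ev (T k)                ≈⟨ +-congʳ (*-congʳ (ev-^w (M k) (B (suc k)))) ⟩
    ev (M k) * geom (weight (M k)) (B (suc k)) * xᵀ k + ev (T k)
      ≡⟨ ≡.cong (λ y → ev (M k) * geom y (B (suc k)) * xᵀ k + ev (T k)) (weight-M k) ⟩
    ev (M k) * geom (x k) (B (suc k)) * xᵀ k + ev (T k)    ∎

  module Step-< (k : ℕ) (b<a : B (2 ℕ.+ k) ℕ.< A (2 ℕ.+ k)) where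
    weight-extension : weight (extension k) ≈ x (suc k) ^ gap k * x k
    weight-extension = begin
      weight (extension k)                           ≈⟨ weight-++ (M (suc k) ^w gap k) (M k) ⟩
      weight (M (suc k) ^w gap k) * weight (M k)     ≈⟨ *-congʳ (weight-^w (M (suc k)) (gap k)) ⟩
      weight (M (suc k)) ^ gap k * weight (M k)      ≡⟨ ≡.cong₂ (λ y z → y ^ gap k * z) (weight-M (suc k)) (weight-M k) ⟩
      x (suc k) ^ gap k * x k                        ∎

    ev-extension : ev (extension k) ≈ ev (M (suc k)) * geom (x (suc k)) (gap k) * x k + ev (M k)
    ev-extension = begin
      ev (extension k)                                             ≈⟨ ev-++-M (M (suc k) ^w gap k) k ⟩
      ev (M (suc k) ^w gap k) * x k + ev (M k)                     ≈⟨ +-congʳ (*-congʳ (ev-^w (M (suc k)) (gap k))) ⟩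
      ev (M (suc k)) * geom (weight (M (suc k))) (gap k) * x k + ev (M k)
        ≡⟨ ≡.cong (λ y → ev (M (suc k)) * geom y (gap k) * x k + ev (M k)) (weight-M (suc k)) ⟩
      ev (M (suc k)) * geom (x (suc k)) (gap k) * x k + ev (M k)   ∎

    ev-R-step : ev (R (2 ℕ.+ k)) ≈ ev (R (suc k)) * (x (suc k) ^ gap k * x k)
                                   + (ev (M (suc k)) * geom (x (suc k)) (gap k) * x k + ev (M k))
    ev-R-step = begin
      ev (R (2 ℕ.+ k))                                        ≈⟨ ev-R≈ev-R̂ (2 ℕ.+ k) ⟩
      ev (R̂ (2 ℕ.+ k))                                        ≡⟨ ≡.cong ev (R̂-< k b<a) ⟩
      ev (R̂ (suc k) ++ extension k)                           ≈⟨ ev-++ (R̂ (suc k)) (extension k) ⟩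
      ev (R̂ (suc k)) * weight (extension k) + ev (extension k)
        ≈⟨ +-cong (*-cong (sym (ev-R≈ev-R̂ (suc k))) weight-extension) ev-extension ⟩
      ev (R (suc k)) * (x (suc k) ^ gap k * x k) + (ev (M (suc k)) * geom (x (suc k)) (gap k) * x k + ev (M k))
        ∎

    xᴿ-step : xᴿ (2 ℕ.+ k) ≈ x (suc k) ^ gap k * x k * xᴿ (suc k)
    xᴿ-step = begin
      xᴿ (2 ℕ.+ k)                              ≡⟨ ≡.trans (≡.sym (weight-R̂ (2 ℕ.+ k))) (≡.cong weight (R̂-< k b<a)) ⟩
      weight (R̂ (suc k) ++ extension k)         ≈⟨ weight-++ (R̂ (suc k)) (extension k) ⟩
      weight (R̂ (suc k)) * weight (extension k) ≈⟨ *-comm _ _ ⟩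
      weight (extension k) * weight (R̂ (suc k)) ≈⟨ *-cong weight-extension (reflexive (weight-R̂ (suc k))) ⟩
      x (suc k) ^ gap k * x k * xᴿ (suc k)      ∎

  module Step-≡ (k : ℕ) (b≡a : B (2 ℕ.+ k) ≡ A (2 ℕ.+ k)) where
    ev-R-step : ev (R (2 ℕ.+ k)) ≈ ev (R k)
    ev-R-step = trans (ev-R≈ev-R̂ (2 ℕ.+ k)) (trans (reflexive (≡.cong ev (R̂-≡ k b≡a))) (sym (ev-R≈ev-R̂ k)))

    xᴿ-step : xᴿ (2 ℕ.+ k) ≡ xᴿ k
    xᴿ-step = ≡.trans (≡.sym (weight-R̂ (2 ℕ.+ k))) (≡.trans (≡.cong weight (R̂-≡ k b≡a)) (weight-R̂ k))

    T-step : T (suc k) ≡ T k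
    T-step = T-zero-digit k (full-digit⇒previous-zero k b≡a)

    xᵀ-step : xᵀ (suc k) ≡ xᵀ k
    xᵀ-step = ≡.trans (≡.sym (weight-T (suc k))) (≡.trans (≡.cong weight T-step) (weight-T k))

    xᴿx-swap : xᴿ (suc k) * x k ≈ xᴿ k * x (suc k)
    xᴿx-swap = begin
      xᴿ (suc k) * x k                   ≈⟨ *-congˡ (x≈xᴿxᵀ k) ⟩
      xᴿ (suc k) * (xᴿ k * xᵀ k)         ≈⟨ solve 3 (λ ρ₁ ρ₀ D → ρ₁ :* (ρ₀ :* D) := ρ₀ :* (ρ₁ :* D))
                                                    refl (xᴿ (suc k)) (xᴿ k) (xᵀ k) ⟩
      xᴿ k * (xᴿ (suc k) * xᵀ k)         ≡⟨ ≡.cong (λ D → xᴿ k * (xᴿ (suc k) * D)) xᵀ-step ⟨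
      xᴿ k * (xᴿ (suc k) * xᵀ (suc k))   ≈⟨ *-congˡ (x≈xᴿxᵀ (suc k)) ⟨
      xᴿ k * x (suc k)                   ∎

module Relations {c ℓ : Level} (F : Field c ℓ) (A B : ℕ → ℕ) (cf : CFDigits A) (os : OstrowskiDigits A B)
  (a b : Field.Carrier F) (a≉0 : ¬ (Field._≈_ F a (Field.0# F))) (b≉0 : ¬ (Field._≈_ F b (Field.0# F)))
  (x≉1 : ∀ k → ¬ (Field._≈_ F (InField.Objects.x F A B a b k) (Field.1# F))) where
  open Field F
  open InField F
  open Sturm A B
  open Objects A B a b
  open FieldProperties F
  open FormalFractions F
  open SturmWords A B cf os
  open Evaluation F A B cf os a b
  open IntegerCoefficients commutativeRing using (solve; _:=_; _:+_; _:*_; _:-_; :0; :1)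
  open import Relation.Binary.Reasoning.Setoid setoid

  fV : ℕ → Frac
  fV k = ((b - 1#) * ev (V k)) , (x k - 1#)

  fV-form : ∀ k → fV k ≋ ((b - 1#) * (ev (R k) * xᵀ k + ev (T k)) , x k - 1#)
  fV-form k = *-congˡ (ev-++-T (R k) k) , refl

  f4⁻≋fV : ∀ k → f4⁻ k ≋ fV k
  f4⁻≋fV zero    = solve 1 (λ b → :0 := (b :- :1) :* (:0 :* :1 :* :1 :+ :0)) refl b
                 , solve 1 (λ b → b :- :1 := b :* :1 :* :1 :- :1) refl b
  f4⁻≋fV (suc k) = ≋-refl

  f2-form : ∀ k → f2 k ≋ ((b - 1#) * (ev (R (suc k)) * xᵀ k + ev (T k)) , xᴿ (suc k) * xᵀ k - 1#)
  f2-form k = *-congˡ (ev-++-T (R (suc k)) k) , +-congʳ (mon-shift (suc k) (t k) (t̃ k))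

  f3-form : ∀ k → f3 k ≋ ((b - 1#) * ((ev (R (suc k)) * x k + ev (M k)) - ev (R (suc k))) , xᴿ (suc k) * (x k - 1#))
  f3-form k = *-congˡ (+-congʳ (ev-++-M (R (suc k)) k)) , refl

  b≉1 : ¬ (b ≈ 1#)
  b≉1 b≈1 = x≉1 0 (trans (solve 1 (λ b → b :* :1 :* :1 := b) refl b) b≈1)

  x≉0 : ∀ k → ¬ (x k ≈ 0#)
  x≉0 k = *-≉0 (^-≉0 b≉0 (q k)) (^-≉0 a≉0 (p k))

  cc-zero : cc 0 * (b - 1#) ≈ xᴿ 1 - xᴿ 0
  cc-zero = begin
    cc 0 * (b - 1#)           ≈⟨ /-*-cancel (x≉1⇒x-1≉0 b≉1) ⟩
    b ^ (A 1 ∸ B 1) * a - b   ≈⟨ +-cong xᴿ-one (-‿cong xᴿ-zero) ⟨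
    xᴿ 1 - xᴿ 0               ∎
    where
    r-one : r 1 ≡ + (A 1 ∸ B 1)
    r-one = ≡.trans (≡.cong (λ n → + A 1 ℤ.- + n) (ℕ.*-identityʳ (B 1))) (+m-+n≡+[m∸n] (ℕ.<⇒≤ first-digit))
    r̃-one : r̃ 1 ≡ + 1
    r̃-one = ≡.cong (λ n → + 1 ℤ.- + n) (ℕ.*-zeroʳ (B 1))
    xᴿ-one : xᴿ 1 ≈ b ^ (A 1 ∸ B 1) * a
    xᴿ-one = trans (reflexive (≡.cong₂ mon r-one r̃-one)) (*-congˡ (*-identityʳ a))
    xᴿ-zero : xᴿ 0 ≈ b
    xᴿ-zero = trans (*-identityʳ _) (*-identityʳ b)

  cc-< : ∀ j → B (2 ℕ.+ j) ℕ.< A (2 ℕ.+ j) → cc (suc j) ≈ xᴿ (suc j) * x j * geom (x (suc j)) (gap j)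
  cc-< j b<a = begin
    cc (suc j)                                ≡⟨ ≡.cong (λ e → (y * ((X ^ℤ e) - 1#)) / (X - 1#)) exponent ⟩
    (y * (X ^ gap j - 1#)) / (X - 1#)         ≈⟨ geom-quotient y (gap j) (x≉1 (suc j)) ⟩
    y * geom X (gap j)                        ≈⟨ *-congʳ (mon-shift (suc j) (q j) (p j)) ⟩
    xᴿ (suc j) * x j * geom X (gap j)         ∎
    where
    X = x (suc j)
    y = mon (r (suc j) ℤ.+ + q j) (r̃ (suc j) ℤ.+ + p j)
    exponent : + A (2 ℕ.+ j) ℤ.- + B (2 ℕ.+ j) ℤ.- + 1 ≡ + gap j
    exponent = ≡.trans (≡.cong (ℤ._- + 1) (+m-+n≡+[m∸n] (ℕ.<⇒≤ b<a))) (+m-+n≡+[m∸n] (ℕ.m<n⇒0<n∸m b<a))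

  cc-≡ : ∀ j → B (2 ℕ.+ j) ≡ A (2 ℕ.+ j) → cc (suc j) ≈ - xᴿ j
  cc-≡ j b≡a = begin
    cc (suc j)                                         ≡⟨ ≡.cong (λ e → (y * ((X ^ℤ e) - 1#)) / (X - 1#)) exponent ⟩
    (y * ((X ^ℤ -[1+ 0 ]) - 1#)) / (X - 1#)            ≈⟨ *-congʳ (*-congʳ (trans (mon-shift (suc j) (q j) (p j)) xᴿx-swap)) ⟩
    ((xᴿ j * X) * ((X ^ℤ -[1+ 0 ]) - 1#)) / (X - 1#)   ≈⟨ inverse-quotient (xᴿ j) (x≉0 (suc j)) (x≉1 (suc j)) ⟩
    - xᴿ j                                             ∎
    where
    open Step-≡ j b≡a using (xᴿx-swap)
    X = x (suc j)
    y = mon (r (suc j) ℤ.+ + q j) (r̃ (suc j) ℤ.+ + p j)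
    exponent : + A (2 ℕ.+ j) ℤ.- + B (2 ℕ.+ j) ℤ.- + 1 ≡ -[1+ 0 ]
    exponent = ≡.trans (≡.cong (λ m → + A (2 ℕ.+ j) ℤ.- + m ℤ.- + 1) b≡a)
                       (≡.cong (ℤ._- + 1) (ℤ.+-inverseʳ (+ A (2 ℕ.+ j))))

  ff-form : ∀ k → ff k ≈ xᵀ k * geom (x k) (B (suc k))
  ff-form k = geom-quotient (xᵀ k) (B (suc k)) (x≉1 k)

  module At (k : ℕ) = Skeleton (b - 1#) (ev (R k)) (ev (R (suc k))) (ev (T k)) (xᵀ k) (xᴿ k) (xᴿ (suc k))

  rel1 : ∀ k → f1 k ≐ cc k · f4⁻ k ∔ f3⁻ k
  rel1 zero = rel1-zero-skeleton ev-R-one ev-R-zero cc-zero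
    where
    ev-R-one : ev (R 1) ≈ 1#
    ev-R-one = trans (ev-0∷ (R̂ 1)) (trans (ev-0ⁿ++ (A 1 ∸ B 1 ∸ 1) [ true ]) (solve 0 (:1 :* :1 :* :1 :+ :0 := :1) refl))
    ev-R-zero : ev (R 0) ≈ 0#
    ev-R-zero = solve 0 (:0 :* :1 :* :1 :+ :0 := :0) refl
  rel1 (suc j) = [ rel1-< , rel1-≡ ]′ (digit-cases j)
    where
    rel1-< : B (2 ℕ.+ j) ℕ.< A (2 ℕ.+ j) → f1 (suc j) ≐ cc (suc j) · f4 j ∔ f3 j
    rel1-< b<a = ≐-resp ≋-refl (cc-< j b<a) (fV-form (suc j)) (f3-form j)
      (rel1-<-skeleton ev-R-step xᴿ-step (sym (geom-telescope (x (suc j)) (gap j))) (ev-M (suc j)) (x≈xᴿxᵀ (suc j)))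
      where open Step-< j b<a
    rel1-≡ : B (2 ℕ.+ j) ≡ A (2 ℕ.+ j) → f1 (suc j) ≐ cc (suc j) · f4 j ∔ f3 j
    rel1-≡ b≡a = ≐-resp (*-congˡ (+-congʳ ev-R-step) , +-congʳ (reflexive xᴿ-step)) (cc-≡ j b≡a) fV-form′ (f3-form j)
      (rel1-≡-skeleton (trans (x≈xᴿxᵀ (suc j)) (*-congˡ (reflexive xᵀ-step))) (x≈xᴿxᵀ j) (ev-M j))
      where
      open Step-≡ j b≡a
      fV-form′ : fV (suc j) ≋ ((b - 1#) * (ev (R (suc j)) * xᵀ j + ev (T j)) , x (suc j) - 1#)
      fV-form′ = ≋-trans (fV-form (suc j))
                         (*-congˡ (+-cong (*-congˡ (reflexive xᵀ-step)) (reflexive (≡.cong ev T-step))) , refl)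

  rel2 : ∀ k → (f2 k ∸f f1 k) ≐ dd k · f1 k ∔ f4⁻ k
  rel2 k = ≐-resp (∸f-cong (f2-form k) ≋-refl) refl ≋-refl (≋-trans (f4⁻≋fV k) (fV-form k))
                  (At.rel2 k (x≈xᴿxᵀ k))

  rel3 : ∀ k → f2 k ≐ 1# · (f2 k ∸f f1 k) ∔ f1 k
  rel3 k = ∸f-split (f2 k) (f1 k)

  rel4 : ∀ k → f3 k ≐ ee k · f2 k ∔ (f2 k ∸f f1 k)
  rel4 k = ≐-resp (f3-form k) refl (f2-form k) (∸f-cong (f2-form k) ≋-refl)
                  (At.rel4 k (x≈xᴿxᵀ k) (ev-M k))

  rel5 : ∀ k → f4 k ≐ ff k · f3 k ∔ f2 k
  rel5 k = ≐-resp (fV-form (suc k)) (ff-form k) (f3-form k) (f2-form k)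
                  (At.rel5 k (x≈xᴿxᵀ (suc k)) xᵀ-suc≈ (ev-T-suc k))
    where
    xᵀ-suc≈ : xᵀ (suc k) ≈ ((x k - 1#) * geom (x k) (B (suc k)) + 1#) * xᵀ k
    xᵀ-suc≈ = trans (xᵀ-suc k) (*-congʳ (sym (geom-telescope (x k) (B (suc k)))))

lemma3p2 : ∀ {c ℓ : Level} (F : Field c ℓ) (A B : ℕ → ℕ) →
  CFDigits A → OstrowskiDigits A B →
  let open Field F in
  let open InField F in
  ∀ (a b : Carrier) →
  ¬ (a ≈ 0#) → ¬ (b ≈ 0#) →
  (∀ (k : ℕ) → ¬ (Objects.x A B a b k ≈ 1#)) →
  let open Objects A B a b in
  ∀ (k : ℕ) →
    (f1 k ≐ cc k · f4⁻ k ∔ f3⁻ k) ×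
    ((f2 k ∸f f1 k) ≐ dd k · f1 k ∔ f4⁻ k) ×
    (f2 k ≐ 1# · (f2 k ∸f f1 k) ∔ f1 k) ×
    (f3 k ≐ ee k · f2 k ∔ (f2 k ∸f f1 k)) ×
    (f4 k ≐ ff k · f3 k ∔ f2 k)
lemma3p2 F A B cf os a b a≉0 b≉0 x≉1 k = rel1 k , rel2 k , rel3 k , rel4 k , rel5 k
  where open Relations F A B cf os a b a≉0 b≉0 x≉1
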